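{- Let $n\geq 2$, and let $A$, $B$, $C$ be the sets of edges of $\Gamma_n$ with imbalance $0$, $1$ and $2$ respectively. Then $$|A|=\sum_{i=3}^{n-2}F_{i-2}F_{n-i-1}+2F_{n-2},\qquad |B|=2\sum_{i=1}^{n-3}F_iF_{n-i-2}+2F_{n-1},\qquad |C|=\sum_{i=2}^{n-1}F_{i-1}F_{n-i}.$$
   Context: $\Gamma_n$ is the subgraph of the hypercube $Q_n$ (binary strings of length $n$, adjacent iff differing in exactly one position) induced by the binary strings of length $n$ with no two consecutive 1's. The imbalance of an edge $\{x,y\}$ is $|d(x)-d(y)|$, degrees taken in $\Gamma_n$. $F_n$ is the Fibonacci sequence $F_0=0$, $F_1=1$, $F_n=F_{n-1}+F_{n-2}$; empty sums are $0$. -}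

module Defs where

open import Data.Bool using (Bool; true; false; _∧_; _∨_; not; if_then_else_)
open import Data.Nat using (ℕ; zero; suc; _+_; _*_; _∸_; ∣_-_∣; _≡ᵇ_)
open import Data.List using (List; []; _∷_; map; filter; length; concatMap; applyUpTo)
open import Data.Nat.ListAction using (sum)
open import Data.Vec using (Vec; []; _∷_)
open import Data.Product using (_×_; _,_)
open import Relation.Nullary.Decidable using (yes; no)
open import Relation.Binary.PropositionalEquality using (_≡_)
open import Data.Bool.Properties using (T?)

F : ℕ → ℕ
F zero = 0
F (suc zero) = 1
F (suc (suc n)) = F (suc n) + F n

-- Σ[ i = a .. b ] f i  (empty, i.e. 0, when b < a)
Σ-from-to : ℕ → ℕ → (ℕ → ℕ) → ℕ
Σ-from-to a b f = sum (map f (applyUpTo (a +_) (suc b ∸ a)))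

allStrings : (n : ℕ) → List (Vec Bool n)
allStrings zero = [] ∷ []
allStrings (suc n) = concatMap (λ v → (false ∷ v) ∷ (true ∷ v) ∷ []) (allStrings n)

noConsecOnes : ∀ {n} → Vec Bool n → Bool
noConsecOnes [] = true
noConsecOnes (x ∷ []) = true
noConsecOnes (x ∷ y ∷ v) = not (x ∧ y) ∧ noConsecOnes (y ∷ v)

hamming : ∀ {n} → Vec Bool n → Vec Bool n → ℕ
hamming [] [] = 0
hamming (x ∷ v) (y ∷ w) = (if (x Data.Bool.xor y) then 1 else 0) + hamming v w
  where import Data.Bool

adjacent : ∀ {n} → Vec Bool n → Vec Bool n → Bool
adjacent v w = hamming v w ≡ᵇ 1

-- strict lexicographic order (false < true), used to pick each
-- unordered pair {x,y} exactly once
lexLt : ∀ {n} → Vec Bool n → Vec Bool n → Bool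
lexLt [] [] = false
lexLt (false ∷ v) (true ∷ w) = true
lexLt (true ∷ v) (false ∷ w) = false
lexLt (false ∷ v) (false ∷ w) = lexLt v w
lexLt (true ∷ v) (true ∷ w) = lexLt v w

vertices : (n : ℕ) → List (Vec Bool n)
vertices n = filter (λ v → T? (noConsecOnes v)) (allStrings n)

deg : (n : ℕ) → Vec Bool n → ℕ
deg n x = length (filter (λ y → T? (adjacent x y)) (vertices n))

edges : (n : ℕ) → List (Vec Bool n × Vec Bool n)
edges n = concatMap (λ x → map (x ,_) (filter (λ y → T? (adjacent x y ∧ lexLt x y)) (vertices n))) (vertices n)

imbalance : (n : ℕ) → Vec Bool n × Vec Bool n → ℕ
imbalance n (x , y) = ∣ deg n x - deg n y ∣

edgesWithImbalance : (n k : ℕ) → ℕ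
edgesWithImbalance n k = length (filter (λ e → T? (imbalance n e ≡ᵇ k)) (edges n))

-- The edges of Γ_n are the pairs {x, toggle i x} in which bit i of x and both its neighbours are 0
-- (i is raisable in x). Raising bit i changes the degree only at positions i-1 and i+1: each stops
-- being toggleable, and was toggleable exactly when it exists and bit i-2, resp. i+2, is 0. So the
-- imbalance of the edge counts these two blocking events. Cutting x into a prefix of length i and a
-- suffix of length j+1 = n-i, prefixes with and without a blocked left neighbour number F_i and
-- F_{i-1}, suffixes F_j and F_{j-1} (with F_{-1} = 1); summing the products over i gives Fibonacci
-- convolutions, which reindex to the three stated sums.

{-# OPTIONS --safe #-}
module Submission where

open import Defs
open import Data.Bool using (Bool; true; false; _∧_; _∨_; not)
open import Data.Bool.Properties using (T?; T-≡; ∧-assoc; ∧-comm; ∧-identityʳ; ∧-zeroʳ; ∨-zeroʳ; not-involutive)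
open import Data.List using (List; []; _∷_; map; filter; length; concatMap; applyUpTo; _++_)
open import Data.List.Properties using (map-++; map-∘)
open import Data.Nat using (ℕ; zero; suc; _+_; _*_; _∸_; _<_; _≤_; _≡ᵇ_; _<ᵇ_; ∣_-_∣; s≤s; z≤n)
open import Data.Nat.ListAction using (sum)
open import Data.Nat.ListAction.Properties using (sum-++)
open import Data.Nat.Properties
open import Algebra.Properties.CommutativeSemigroup +-commutativeSemigroup using (interchange)
open import Data.Nat.Tactic.RingSolver using (solve-∀)
open import Data.Product using (_×_; _,_; proj₁; proj₂)
open import Data.Vec using (Vec; []; _∷_; _∷ʳ_) renaming (_++_ to _++ᵥ_)
open import Function using (_∘_)
open import Function.Bundles using (Equivalence)
open import Relation.Binary.PropositionalEquality
open import Relation.Nullary using (yes; no; contradiction)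
open ≡-Reasoning

⟦_⟧ : Bool → ℕ
⟦ true ⟧ = 1
⟦ false ⟧ = 0

⟦∧⟧ : ∀ a b → ⟦ a ∧ b ⟧ ≡ ⟦ a ⟧ * ⟦ b ⟧
⟦∧⟧ true  b = sym (+-identityʳ ⟦ b ⟧)
⟦∧⟧ false b = refl

⟦∧⟧-* : ∀ a b t → ⟦ a ⟧ * (⟦ b ⟧ * t) ≡ ⟦ a ∧ b ⟧ * t
⟦∧⟧-* true  b t = +-identityʳ (⟦ b ⟧ * t)
⟦∧⟧-* false b t = refl

∑ : {A : Set} → List A → (A → ℕ) → ℕ
∑ xs f = sum (map f xs)

module _ {A : Set} where

  ∑-cong : ∀ (xs : List A) {f g : A → ℕ} → (∀ x → f x ≡ g x) → ∑ xs f ≡ ∑ xs g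
  ∑-cong []       f≗g = refl
  ∑-cong (x ∷ xs) f≗g = cong₂ _+_ (f≗g x) (∑-cong xs f≗g)

  ∑-zero : ∀ (xs : List A) → ∑ xs (λ _ → 0) ≡ 0
  ∑-zero []       = refl
  ∑-zero (x ∷ xs) = ∑-zero xs

  ∑-+ : ∀ (xs : List A) (f g : A → ℕ) → ∑ xs (λ x → f x + g x) ≡ ∑ xs f + ∑ xs g
  ∑-+ []       f g = refl
  ∑-+ (x ∷ xs) f g = trans (cong (f x + g x +_) (∑-+ xs f g)) (interchange (f x) (g x) _ _)

  ∑-*ˡ : ∀ (xs : List A) c (f : A → ℕ) → ∑ xs (λ x → c * f x) ≡ c * ∑ xs f
  ∑-*ˡ []       c f = sym (*-zeroʳ c)
  ∑-*ˡ (x ∷ xs) c f = trans (cong (c * f x +_) (∑-*ˡ xs c f)) (sym (*-distribˡ-+ c (f x) _))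

  ∑-*ʳ : ∀ (xs : List A) c (f : A → ℕ) → ∑ xs (λ x → f x * c) ≡ ∑ xs f * c
  ∑-*ʳ xs c f = begin
    ∑ xs (λ x → f x * c) ≡⟨ ∑-cong xs (λ x → *-comm (f x) c) ⟩
    ∑ xs (λ x → c * f x) ≡⟨ ∑-*ˡ xs c f ⟩
    c * ∑ xs f           ≡⟨ *-comm c _ ⟩
    ∑ xs f * c           ∎

  ∑-++ : ∀ (xs ys : List A) (f : A → ℕ) → ∑ (xs ++ ys) f ≡ ∑ xs f + ∑ ys f
  ∑-++ xs ys f = trans (cong sum (map-++ f xs ys)) (sum-++ (map f xs) (map f ys))

  ∑-filter : ∀ (xs : List A) (p : A → Bool) (f : A → ℕ) →
             ∑ (filter (λ x → T? (p x)) xs) f ≡ ∑ xs (λ x → ⟦ p x ⟧ * f x)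
  ∑-filter []       p f = refl
  ∑-filter (x ∷ xs) p f with p x
  ... | true  = cong₂ _+_ (sym (+-identityʳ (f x))) (∑-filter xs p f)
  ... | false = ∑-filter xs p f

  length-filter≡∑ : ∀ (xs : List A) (p : A → Bool) → length (filter (λ x → T? (p x)) xs) ≡ ∑ xs (λ x → ⟦ p x ⟧)
  length-filter≡∑ xs p = begin
    length (filter (λ x → T? (p x)) xs) ≡⟨ length≡∑1 (filter (λ x → T? (p x)) xs) ⟩
    ∑ (filter (λ x → T? (p x)) xs) (λ _ → 1) ≡⟨ ∑-filter xs p (λ _ → 1) ⟩
    ∑ xs (λ x → ⟦ p x ⟧ * 1) ≡⟨ ∑-cong xs (λ x → *-identityʳ ⟦ p x ⟧) ⟩
    ∑ xs (λ x → ⟦ p x ⟧) ∎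
    where
    length≡∑1 : ∀ (ys : List A) → length ys ≡ ∑ ys (λ _ → 1)
    length≡∑1 []       = refl
    length≡∑1 (y ∷ ys) = cong suc (length≡∑1 ys)

  ∑-split-on : ∀ (xs : List A) (f : A → ℕ) (a : A → Bool) (h : Bool → ℕ) →
               ∑ xs (λ x → f x * h (a x)) ≡ ∑ xs (λ x → f x * ⟦ a x ⟧) * h true + ∑ xs (λ x → f x * ⟦ not (a x) ⟧) * h false
  ∑-split-on xs f a h = begin
    ∑ xs (λ x → f x * h (a x))
      ≡⟨ ∑-cong xs (λ x → split (f x) (a x)) ⟩
    ∑ xs (λ x → f x * ⟦ a x ⟧ * h true + f x * ⟦ not (a x) ⟧ * h false)
      ≡⟨ ∑-+ xs _ _ ⟩
    ∑ xs (λ x → f x * ⟦ a x ⟧ * h true) + ∑ xs (λ x → f x * ⟦ not (a x) ⟧ * h false)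
      ≡⟨ cong₂ _+_ (∑-*ʳ xs (h true) _) (∑-*ʳ xs (h false) _) ⟩
    ∑ xs (λ x → f x * ⟦ a x ⟧) * h true + ∑ xs (λ x → f x * ⟦ not (a x) ⟧) * h false ∎
    where
    split : ∀ m b → m * h b ≡ m * ⟦ b ⟧ * h true + m * ⟦ not b ⟧ * h false
    split m true  = one-zero m (h true) (h false)
      where one-zero : ∀ m t u → m * t ≡ m * 1 * t + m * 0 * u
            one-zero = solve-∀
    split m false = zero-one m (h true) (h false)
      where zero-one : ∀ m t u → m * u ≡ m * 0 * t + m * 1 * u
            zero-one = solve-∀

∑-map : ∀ {A B : Set} (xs : List A) (g : A → B) (f : B → ℕ) → ∑ (map g xs) f ≡ ∑ xs (λ x → f (g x))
∑-map xs g f = cong sum (sym (map-∘ xs))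

∑-concatMap : ∀ {A B : Set} (xs : List A) (g : A → List B) (f : B → ℕ) →
              ∑ (concatMap g xs) f ≡ ∑ xs (λ x → ∑ (g x) f)
∑-concatMap []       g f = refl
∑-concatMap (x ∷ xs) g f = trans (∑-++ (g x) (concatMap g xs) f) (cong (∑ (g x) f +_) (∑-concatMap xs g f))

∑-∑-split-on : ∀ {A B : Set} (xs : List A) (ys : List B) (f : A → ℕ) (g : B → ℕ) (a : A → Bool) (b : B → Bool)
                 (h : Bool → Bool → ℕ) →
  ∑ xs (λ x → f x * ∑ ys (λ y → g y * h (a x) (b y)))
    ≡ ∑ xs (λ x → f x * ⟦ a x ⟧) * (∑ ys (λ y → g y * ⟦ b y ⟧) * h true true + ∑ ys (λ y → g y * ⟦ not (b y) ⟧) * h true false)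
    + ∑ xs (λ x → f x * ⟦ not (a x) ⟧) * (∑ ys (λ y → g y * ⟦ b y ⟧) * h false true + ∑ ys (λ y → g y * ⟦ not (b y) ⟧) * h false false)
∑-∑-split-on xs ys f g a b h = begin
  ∑ xs (λ x → f x * ∑ ys (λ y → g y * h (a x) (b y)))
    ≡⟨ ∑-cong xs (λ x → cong (f x *_) (∑-split-on ys g b (h (a x)))) ⟩
  ∑ xs (λ x → f x * H (a x))
    ≡⟨ ∑-split-on xs f a H ⟩
  ∑ xs (λ x → f x * ⟦ a x ⟧) * H true + ∑ xs (λ x → f x * ⟦ not (a x) ⟧) * H false ∎
  where
  H : Bool → ℕ
  H α = ∑ ys (λ y → g y * ⟦ b y ⟧) * h α true + ∑ ys (λ y → g y * ⟦ not (b y) ⟧) * h α false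

∑< : ℕ → (ℕ → ℕ) → ℕ
∑< zero    f = 0
∑< (suc n) f = f 0 + ∑< n (λ i → f (suc i))

∑<-cong : ∀ n {f g : ℕ → ℕ} → (∀ i → i < n → f i ≡ g i) → ∑< n f ≡ ∑< n g
∑<-cong zero    f≗g = refl
∑<-cong (suc n) f≗g = cong₂ _+_ (f≗g 0 (s≤s z≤n)) (∑<-cong n (λ i i<n → f≗g (suc i) (s≤s i<n)))

∑<-+ : ∀ n (f g : ℕ → ℕ) → ∑< n (λ i → f i + g i) ≡ ∑< n f + ∑< n g
∑<-+ zero    f g = refl
∑<-+ (suc n) f g = trans (cong (f 0 + g 0 +_) (∑<-+ n (λ i → f (suc i)) (λ i → g (suc i))))
                         (interchange (f 0) (g 0) _ _)

∑<-zero : ∀ n → ∑< n (λ _ → 0) ≡ 0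
∑<-zero zero    = refl
∑<-zero (suc n) = ∑<-zero n

∑<-indicator : ∀ n m (p : ℕ → Bool) → ∑< n (λ j → ⟦ (j ≡ᵇ m) ∧ p j ⟧) ≡ ⟦ (m <ᵇ n) ∧ p m ⟧
∑<-indicator zero    m       p = refl
∑<-indicator (suc n) zero    p = trans (cong (⟦ p 0 ⟧ +_) (∑<-zero n)) (+-identityʳ _)
∑<-indicator (suc n) (suc m) p = ∑<-indicator n m (λ j → p (suc j))

∑<-∷ʳ : ∀ n (f : ℕ → ℕ) → ∑< (suc n) f ≡ ∑< n f + f n
∑<-∷ʳ zero    f = +-identityʳ (f 0)
∑<-∷ʳ (suc n) f = trans (cong (f 0 +_) (∑<-∷ʳ n (λ i → f (suc i)))) (sym (+-assoc (f 0) _ _))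

∑-∑< : ∀ {A : Set} (xs : List A) n (g : A → ℕ → ℕ) → ∑ xs (λ x → ∑< n (g x)) ≡ ∑< n (λ i → ∑ xs (λ x → g x i))
∑-∑< xs zero    g = ∑-zero xs
∑-∑< xs (suc n) g = trans (∑-+ xs (λ x → g x 0) _) (cong (∑ xs (λ x → g x 0) +_) (∑-∑< xs n (λ x i → g x (suc i))))

Σ-from-to≡∑< : ∀ a b (f : ℕ → ℕ) → Σ-from-to a b f ≡ ∑< (suc b ∸ a) (λ t → f (a + t))
Σ-from-to≡∑< a b f = go (a +_) (suc b ∸ a)
  where
  go : ∀ g m → sum (map f (applyUpTo g m)) ≡ ∑< m (λ t → f (g t))
  go g zero    = refl
  go g (suc m) = cong (f (g 0) +_) (go (λ t → g (suc t)) m)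

∑Q : (n : ℕ) → (Vec Bool n → ℕ) → ℕ
∑Q n = ∑ (allStrings n)

∑Q-suc : ∀ n (f : Vec Bool (suc n) → ℕ) →
         ∑Q (suc n) f ≡ ∑Q n (λ v → f (false ∷ v)) + ∑Q n (λ v → f (true ∷ v))
∑Q-suc n f = begin
  ∑Q (suc n) f
    ≡⟨ ∑-concatMap (allStrings n) _ f ⟩
  ∑Q n (λ v → f (false ∷ v) + (f (true ∷ v) + 0))
    ≡⟨ ∑-cong (allStrings n) (λ v → cong (f (false ∷ v) +_) (+-identityʳ _)) ⟩
  ∑Q n (λ v → f (false ∷ v) + f (true ∷ v))
    ≡⟨ ∑-+ (allStrings n) _ _ ⟩
  ∑Q n (λ v → f (false ∷ v)) + ∑Q n (λ v → f (true ∷ v)) ∎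

∑Q-++ : ∀ m k (f : Vec Bool (m + k) → ℕ) → ∑Q (m + k) f ≡ ∑Q m (λ u → ∑Q k (λ v → f (u ++ᵥ v)))
∑Q-++ zero    k f = sym (+-identityʳ _)
∑Q-++ (suc m) k f = begin
  ∑Q (suc (m + k)) f
    ≡⟨ ∑Q-suc (m + k) f ⟩
  ∑Q (m + k) (λ v → f (false ∷ v)) + ∑Q (m + k) (λ v → f (true ∷ v))
    ≡⟨ cong₂ _+_ (∑Q-++ m k (λ v → f (false ∷ v))) (∑Q-++ m k (λ v → f (true ∷ v))) ⟩
  ∑Q m (λ u → ∑Q k (λ v → f (false ∷ u ++ᵥ v))) + ∑Q m (λ u → ∑Q k (λ v → f (true ∷ u ++ᵥ v)))
    ≡⟨ ∑Q-suc m (λ u → ∑Q k (λ v → f (u ++ᵥ v))) ⟨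
  ∑Q (suc m) (λ u → ∑Q k (λ v → f (u ++ᵥ v))) ∎

∑Q-∷ʳ : ∀ m (f : Vec Bool (suc m) → ℕ) → ∑Q (suc m) f ≡ ∑Q m (λ u → f (u ∷ʳ false) + f (u ∷ʳ true))
∑Q-∷ʳ zero    f = sym (+-assoc (f (false ∷ [])) (f (true ∷ [])) 0)
∑Q-∷ʳ (suc m) f = begin
  ∑Q (suc (suc m)) f
    ≡⟨ ∑Q-suc (suc m) f ⟩
  ∑Q (suc m) (λ v → f (false ∷ v)) + ∑Q (suc m) (λ v → f (true ∷ v))
    ≡⟨ cong₂ _+_ (∑Q-∷ʳ m (λ v → f (false ∷ v))) (∑Q-∷ʳ m (λ v → f (true ∷ v))) ⟩
  ∑Q m (λ u → f (false ∷ (u ∷ʳ false)) + f (false ∷ (u ∷ʳ true))) + ∑Q m (λ u → f (true ∷ (u ∷ʳ false)) + f (true ∷ (u ∷ʳ true)))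
    ≡⟨ ∑Q-suc m (λ u → f (u ∷ʳ false) + f (u ∷ʳ true)) ⟨
  ∑Q (suc m) (λ u → f (u ∷ʳ false) + f (u ∷ʳ true)) ∎

-- Degrees in Γ_n

-- Positions outside the string read as 0, so boundary positions need no special treatment.
bit : ∀ {n} → Vec Bool n → ℕ → Bool
bit []      _       = false
bit (b ∷ x) zero    = b
bit (b ∷ x) (suc i) = bit x i

bitBefore : ∀ {n} → Vec Bool n → ℕ → Bool
bitBefore x zero    = false
bitBefore x (suc i) = bit x i

toggle : ∀ {n} → ℕ → Vec Bool n → Vec Bool n
toggle i       []      = []
toggle zero    (b ∷ x) = not b ∷ x
toggle (suc i) (b ∷ x) = b ∷ toggle i x

∑Q-hamming-0 : ∀ {n} (x : Vec Bool n) (P : Vec Bool n → ℕ) → ∑Q n (λ y → ⟦ hamming x y ≡ᵇ 0 ⟧ * P y) ≡ P x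
∑Q-hamming-0 []                P = trans (+-identityʳ _) (+-identityʳ (P []))
∑Q-hamming-0 {suc n} (false ∷ x) P =
  trans (∑Q-suc n _) (trans (cong₂ _+_ (∑Q-hamming-0 x (λ y → P (false ∷ y))) (∑-zero (allStrings n))) (+-identityʳ _))
∑Q-hamming-0 {suc n} (true ∷ x) P =
  trans (∑Q-suc n _) (cong₂ _+_ (∑-zero (allStrings n)) (∑Q-hamming-0 x (λ y → P (true ∷ y))))

∑Q-hamming-1 : ∀ {n} (x : Vec Bool n) (P : Vec Bool n → ℕ) →
               ∑Q n (λ y → ⟦ hamming x y ≡ᵇ 1 ⟧ * P y) ≡ ∑< n (λ i → P (toggle i x))
∑Q-hamming-1 []                P = refl
∑Q-hamming-1 {suc n} (false ∷ x) P =
  trans (∑Q-suc n _) (trans (cong₂ _+_ (∑Q-hamming-1 x (λ y → P (false ∷ y))) (∑Q-hamming-0 x (λ y → P (true ∷ y))))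
                            (+-comm _ (P (true ∷ x))))
∑Q-hamming-1 {suc n} (true ∷ x) P =
  trans (∑Q-suc n _) (cong₂ _+_ (∑Q-hamming-0 x (λ y → P (false ∷ y))) (∑Q-hamming-1 x (λ y → P (true ∷ y))))

toggleable : ∀ {n} → Vec Bool n → ℕ → Bool
toggleable x i = bit x i ∨ (not (bitBefore x i) ∧ not (bit x (suc i)))

noConsecOnes-toggle : ∀ {n} (x : Vec Bool n) i → i < n → noConsecOnes x ≡ true →
                      noConsecOnes (toggle i x) ≡ toggleable x i
noConsecOnes-toggle (a ∷ [])            zero          _         _ = sym (∨-zeroʳ a)
noConsecOnes-toggle (a ∷ [])            (suc i)       (s≤s ())  _
noConsecOnes-toggle (true  ∷ true  ∷ x) _             _         ()
noConsecOnes-toggle (true  ∷ false ∷ x) zero          _         v = v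
noConsecOnes-toggle (false ∷ true  ∷ x) zero          _         _ = refl
noConsecOnes-toggle (false ∷ false ∷ x) zero          _         v = v
noConsecOnes-toggle (true  ∷ false ∷ x) (suc zero)    _         _ = refl
noConsecOnes-toggle (false ∷ b ∷ x)     (suc zero)    _         v = noConsecOnes-toggle (b ∷ x) zero (s≤s z≤n) v
noConsecOnes-toggle (true  ∷ false ∷ x) (suc (suc i)) (s≤s i<n) v = noConsecOnes-toggle (false ∷ x) (suc i) i<n v
noConsecOnes-toggle (false ∷ b ∷ x)     (suc (suc i)) (s≤s i<n) v = noConsecOnes-toggle (b ∷ x) (suc i) i<n v

deg≡∑toggleable : ∀ n (x : Vec Bool n) → noConsecOnes x ≡ true → deg n x ≡ ∑< n (λ i → ⟦ toggleable x i ⟧)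
deg≡∑toggleable n x valid = begin
  deg n x
    ≡⟨ length-filter≡∑ (vertices n) (adjacent x) ⟩
  ∑ (vertices n) (λ y → ⟦ adjacent x y ⟧)
    ≡⟨ ∑-filter (allStrings n) noConsecOnes (λ y → ⟦ adjacent x y ⟧) ⟩
  ∑Q n (λ y → ⟦ noConsecOnes y ⟧ * ⟦ adjacent x y ⟧)
    ≡⟨ ∑-cong (allStrings n) (λ y → *-comm ⟦ noConsecOnes y ⟧ _) ⟩
  ∑Q n (λ y → ⟦ adjacent x y ⟧ * ⟦ noConsecOnes y ⟧)
    ≡⟨ ∑Q-hamming-1 x (λ y → ⟦ noConsecOnes y ⟧) ⟩
  ∑< n (λ i → ⟦ noConsecOnes (toggle i x) ⟧)
    ≡⟨ ∑<-cong n (λ i i<n → cong ⟦_⟧ (noConsecOnes-toggle x i i<n valid)) ⟩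
  ∑< n (λ i → ⟦ toggleable x i ⟧) ∎

bit-toggle-≡ : ∀ {n} (x : Vec Bool n) i → i < n → bit (toggle i x) i ≡ not (bit x i)
bit-toggle-≡ (a ∷ x) zero    _         = refl
bit-toggle-≡ (a ∷ x) (suc i) (s≤s i<n) = bit-toggle-≡ x i i<n

bit-toggle-≢ : ∀ {n} (x : Vec Bool n) i j → j ≢ i → bit (toggle i x) j ≡ bit x j
bit-toggle-≢ []      i       j       _   = refl
bit-toggle-≢ (a ∷ x) zero    zero    j≢i = contradiction refl j≢i
bit-toggle-≢ (a ∷ x) zero    (suc j) _   = refl
bit-toggle-≢ (a ∷ x) (suc i) zero    _   = refl
bit-toggle-≢ (a ∷ x) (suc i) (suc j) j≢i = bit-toggle-≢ x i j (j≢i ∘ cong suc)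

bitBefore-toggle-≢ : ∀ {n} (x : Vec Bool n) i j → j ≢ suc i → bitBefore (toggle i x) j ≡ bitBefore x j
bitBefore-toggle-≢ x i zero    _     = refl
bitBefore-toggle-≢ x i (suc j) j≢1+i = bit-toggle-≢ x i j (j≢1+i ∘ cong suc)

≡ᵇ-refl : ∀ n → (n ≡ᵇ n) ≡ true
≡ᵇ-refl zero    = refl
≡ᵇ-refl (suc n) = ≡ᵇ-refl n

≢⇒≡ᵇ-false : ∀ {m n} → m ≢ n → (m ≡ᵇ n) ≡ false
≢⇒≡ᵇ-false {zero}  {zero}  m≢n = contradiction refl m≢n
≢⇒≡ᵇ-false {zero}  {suc n} _   = refl
≢⇒≡ᵇ-false {suc m} {zero}  _   = refl
≢⇒≡ᵇ-false {suc m} {suc n} m≢n = ≢⇒≡ᵇ-false (m≢n ∘ cong suc)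

raisable : ∀ {n} → Vec Bool n → ℕ → Bool
raisable x i = not (bitBefore x i) ∧ (not (bit x i) ∧ not (bit x (suc i)))

raisable-bits : ∀ {n} (x : Vec Bool n) i → raisable x i ≡ true →
                bitBefore x i ≡ false × bit x i ≡ false × bit x (suc i) ≡ false
raisable-bits x i r with bitBefore x i | bit x i | bit x (suc i)
... | false | false | false = refl , refl , refl

-- The test suc i <ᵇ n is needed: beyond the end, bit (suc (suc i)) reads as 0.
blocksRight : ∀ {n} → Vec Bool n → ℕ → Bool
blocksRight {n} x i = (suc i <ᵇ n) ∧ not (bit x (suc (suc i)))

blocksLeft : ∀ {n} → Vec Bool n → ℕ → Bool
blocksLeft x zero    = false
blocksLeft x (suc i) = not (bitBefore x i)

-- Raising bit i makes positions i-1 and i+1 untoggleable; each was toggleable iff bit i-2,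
-- resp. i+2, is 0. No other position changes status.
toggleable-drop : ∀ {n} (x : Vec Bool n) i → i < n → raisable x i ≡ true → ∀ j →
  ⟦ toggleable x j ⟧ ≡ ⟦ toggleable (toggle i x) j ⟧
                       + (⟦ (j ≡ᵇ suc i) ∧ not (bit x (suc (suc i))) ⟧ + ⟦ (suc j ≡ᵇ i) ∧ not (bitBefore x j) ⟧)
toggleable-drop x i i<n r j with raisable-bits x i r | j ≟ i | j ≟ suc i | suc j ≟ i
... | l , m , r′ | yes refl | _ | _
  rewrite bit-toggle-≡ x i i<n | l | m | r′ | ≢⇒≡ᵇ-false {i} {suc i} (λ ()) | ≢⇒≡ᵇ-false {suc i} {i} (λ ()) = refl
... | l , m , r′ | no _ | yes refl | _
  rewrite bit-toggle-≢ x i (suc i) (λ ()) | bit-toggle-≡ x i i<n | m | r′ | ≡ᵇ-refl i | ≢⇒≡ᵇ-false {suc (suc i)} {i} (λ ()) = sym (+-identityʳ _)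
... | l , m , r′ | no _ | no _ | yes refl
  rewrite bit-toggle-≢ x (suc j) j (λ ()) | bit-toggle-≡ x (suc j) i<n | l | m | ≡ᵇ-refl j | ≢⇒≡ᵇ-false {j} {suc (suc j)} (λ ())
        | ∧-identityʳ (not (bitBefore x j)) | ∧-zeroʳ (not (bitBefore (toggle (suc j) x) j)) = refl
... | _ | no j≢i | no j≢1+i | no 1+j≢i
  rewrite bit-toggle-≢ x i j j≢i | bit-toggle-≢ x i (suc j) 1+j≢i | bitBefore-toggle-≢ x i j j≢1+i
        | ≢⇒≡ᵇ-false j≢1+i | ≢⇒≡ᵇ-false 1+j≢i = sym (+-identityʳ _)

raisable⇒toggleable : ∀ {n} (x : Vec Bool n) i → raisable x i ≡ true → toggleable x i ≡ true
raisable⇒toggleable x i r with raisable-bits x i r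
... | l , m , r′ rewrite l | m | r′ = refl

deg-raise : ∀ n (x : Vec Bool n) i → noConsecOnes x ≡ true → i < n → raisable x i ≡ true →
            deg n x ≡ deg n (toggle i x) + (⟦ blocksRight x i ⟧ + ⟦ blocksLeft x i ⟧)
deg-raise n x i valid i<n r = begin
  deg n x
    ≡⟨ deg≡∑toggleable n x valid ⟩
  ∑< n (λ j → ⟦ toggleable x j ⟧)
    ≡⟨ ∑<-cong n (λ j _ → toggleable-drop x i i<n r j) ⟩
  ∑< n (λ j → ⟦ toggleable y j ⟧ + (right j + left j))
    ≡⟨ trans (∑<-+ n _ _) (cong (∑< n (λ j → ⟦ toggleable y j ⟧) +_) (∑<-+ n right left)) ⟩
  ∑< n (λ j → ⟦ toggleable y j ⟧) + (∑< n right + ∑< n left)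
    ≡⟨ cong₂ _+_ (sym (deg≡∑toggleable n y valid′))
                 (cong₂ _+_ (∑<-indicator n (suc i) (λ _ → not (bit x (suc (suc i))))) (∑left≡blocksLeft i i<n)) ⟩
  deg n y + (⟦ blocksRight x i ⟧ + ⟦ blocksLeft x i ⟧) ∎
  where
  y = toggle i x
  right left : ℕ → ℕ
  right j = ⟦ (j ≡ᵇ suc i) ∧ not (bit x (suc (suc i))) ⟧
  left  j = ⟦ (suc j ≡ᵇ i) ∧ not (bitBefore x j) ⟧
  valid′ : noConsecOnes y ≡ true
  valid′ = trans (noConsecOnes-toggle x i i<n valid) (raisable⇒toggleable x i r)
  ∑left≡blocksLeft : ∀ i → i < n → ∑< n (λ j → ⟦ (suc j ≡ᵇ i) ∧ not (bitBefore x j) ⟧) ≡ ⟦ blocksLeft x i ⟧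
  ∑left≡blocksLeft zero    _   = ∑<-zero n
  ∑left≡blocksLeft (suc k) k<n rewrite ∑<-indicator n k (λ j → not (bitBefore x j))
                           | Equivalence.to T-≡ (<⇒<ᵇ (<-trans (n<1+n k) k<n)) = refl

lexLt-toggle : ∀ {n} (x : Vec Bool n) i → i < n → lexLt x (toggle i x) ≡ not (bit x i)
lexLt-toggle (true  ∷ x) zero    _         = refl
lexLt-toggle (false ∷ x) zero    _         = refl
lexLt-toggle (true  ∷ x) (suc i) (s≤s i<n) = lexLt-toggle x i i<n
lexLt-toggle (false ∷ x) (suc i) (s≤s i<n) = lexLt-toggle x i i<n

toggleable∧not-bit : ∀ {n} (x : Vec Bool n) i → toggleable x i ∧ not (bit x i) ≡ raisable x i
toggleable∧not-bit x i with bitBefore x i | bit x i | bit x (suc i)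
... | true  | true  | _     = refl
... | false | true  | _     = refl
... | true  | false | _     = refl
... | false | false | true  = refl
... | false | false | false = refl

imbalance-weight : ℕ → Bool → Bool → ℕ
imbalance-weight k left right = ⟦ ⟦ right ⟧ + ⟦ left ⟧ ≡ᵇ k ⟧

edgeWeight-toggle : ∀ n k (x : Vec Bool n) i → noConsecOnes x ≡ true → i < n →
  ⟦ noConsecOnes (toggle i x) ⟧ * (⟦ lexLt x (toggle i x) ⟧ * ⟦ imbalance n (x , toggle i x) ≡ᵇ k ⟧)
    ≡ ⟦ raisable x i ⟧ * imbalance-weight k (blocksLeft x i) (blocksRight x i)
edgeWeight-toggle n k x i valid i<n
  rewrite noConsecOnes-toggle x i i<n valid | lexLt-toggle x i i<n
        | ⟦∧⟧-* (toggleable x i) (not (bit x i)) ⟦ imbalance n (x , toggle i x) ≡ᵇ k ⟧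
        | toggleable∧not-bit x i
  with raisable x i in r
... | false = refl
... | true  = cong (λ d → 1 * ⟦ d ≡ᵇ k ⟧) (begin
  ∣ deg n x - deg n (toggle i x) ∣
    ≡⟨ cong ∣_- deg n (toggle i x) ∣ (deg-raise n x i valid i<n r) ⟩
  ∣ deg n (toggle i x) + d - deg n (toggle i x) ∣
    ≡⟨ ∣-∣-comm (deg n (toggle i x) + d) _ ⟩
  ∣ deg n (toggle i x) - deg n (toggle i x) + d ∣
    ≡⟨ ∣m-m+n∣≡n (deg n (toggle i x)) d ⟩
  d ∎)
  where d = ⟦ blocksRight x i ⟧ + ⟦ blocksLeft x i ⟧

-- An edge is listed from its lex-smaller endpoint x, so it is (x , toggle i x) with bit i of x
-- equal to 0, and it lies in Γ_n iff i is raisable in x.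
edges≡∑raisable : ∀ n k → edgesWithImbalance n k ≡
  ∑< n (λ i → ∑Q n (λ x → ⟦ noConsecOnes x ∧ raisable x i ⟧ * imbalance-weight k (blocksLeft x i) (blocksRight x i)))
edges≡∑raisable n k = begin
  edgesWithImbalance n k
    ≡⟨ length-filter≡∑ (edges n) (λ e → imbalance n e ≡ᵇ k) ⟩
  ∑ (edges n) (λ e → ⟦ imbalance n e ≡ᵇ k ⟧)
    ≡⟨ ∑-concatMap (vertices n) (λ x → map (x ,_) (upNeighbours x)) _ ⟩
  ∑ (vertices n) (λ x → ∑ (map (x ,_) (upNeighbours x)) (λ e → ⟦ imbalance n e ≡ᵇ k ⟧))
    ≡⟨ ∑-filter (allStrings n) noConsecOnes _ ⟩
  ∑Q n (λ x → ⟦ noConsecOnes x ⟧ * ∑ (map (x ,_) (upNeighbours x)) (λ e → ⟦ imbalance n e ≡ᵇ k ⟧))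
    ≡⟨ ∑-cong (allStrings n) (λ x → cong (⟦ noConsecOnes x ⟧ *_) (inner x)) ⟩
  ∑Q n (λ x → ⟦ noConsecOnes x ⟧ * ∑Q n (λ y → ⟦ adjacent x y ⟧ * weight x y))
    ≡⟨ ∑-cong (allStrings n) perVertex ⟩
  ∑Q n (λ x → ∑< n (λ i → ⟦ noConsecOnes x ∧ raisable x i ⟧ * imbalance-weight k (blocksLeft x i) (blocksRight x i)))
    ≡⟨ ∑-∑< (allStrings n) n _ ⟩
  ∑< n (λ i → ∑Q n (λ x → ⟦ noConsecOnes x ∧ raisable x i ⟧ * imbalance-weight k (blocksLeft x i) (blocksRight x i))) ∎
  where
  upNeighbours : Vec Bool n → List (Vec Bool n)
  upNeighbours x = filter (λ y → T? (adjacent x y ∧ lexLt x y)) (vertices n)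

  weight : Vec Bool n → Vec Bool n → ℕ
  weight x y = ⟦ noConsecOnes y ⟧ * (⟦ lexLt x y ⟧ * ⟦ imbalance n (x , y) ≡ᵇ k ⟧)

  pull-adjacent : ∀ v a l t → ⟦ v ⟧ * (⟦ a ∧ l ⟧ * t) ≡ ⟦ a ⟧ * (⟦ v ⟧ * (⟦ l ⟧ * t))
  pull-adjacent v true  l t = sym (+-identityʳ _)
  pull-adjacent v false l t = *-zeroʳ ⟦ v ⟧

  inner : ∀ x → ∑ (map (x ,_) (upNeighbours x)) (λ e → ⟦ imbalance n e ≡ᵇ k ⟧) ≡ ∑Q n (λ y → ⟦ adjacent x y ⟧ * weight x y)
  inner x = begin
    ∑ (map (x ,_) (upNeighbours x)) (λ e → ⟦ imbalance n e ≡ᵇ k ⟧)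
      ≡⟨ ∑-map (upNeighbours x) (x ,_) _ ⟩
    ∑ (upNeighbours x) (λ y → ⟦ imbalance n (x , y) ≡ᵇ k ⟧)
      ≡⟨ ∑-filter (vertices n) (λ y → adjacent x y ∧ lexLt x y) _ ⟩
    ∑ (vertices n) (λ y → ⟦ adjacent x y ∧ lexLt x y ⟧ * ⟦ imbalance n (x , y) ≡ᵇ k ⟧)
      ≡⟨ ∑-filter (allStrings n) noConsecOnes _ ⟩
    ∑Q n (λ y → ⟦ noConsecOnes y ⟧ * (⟦ adjacent x y ∧ lexLt x y ⟧ * ⟦ imbalance n (x , y) ≡ᵇ k ⟧))
      ≡⟨ ∑-cong (allStrings n) (λ y → pull-adjacent (noConsecOnes y) (adjacent x y) (lexLt x y) _) ⟩
    ∑Q n (λ y → ⟦ adjacent x y ⟧ * weight x y) ∎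

  perVertex : ∀ x → ⟦ noConsecOnes x ⟧ * ∑Q n (λ y → ⟦ adjacent x y ⟧ * weight x y)
                    ≡ ∑< n (λ i → ⟦ noConsecOnes x ∧ raisable x i ⟧ * imbalance-weight k (blocksLeft x i) (blocksRight x i))
  perVertex x with noConsecOnes x in valid
  ... | false = sym (∑<-zero n)
  ... | true  = begin
    1 * ∑Q n (λ y → ⟦ adjacent x y ⟧ * weight x y)
      ≡⟨ *-identityˡ _ ⟩
    ∑Q n (λ y → ⟦ adjacent x y ⟧ * weight x y)
      ≡⟨ ∑Q-hamming-1 x (weight x) ⟩
    ∑< n (λ i → weight x (toggle i x))
      ≡⟨ ∑<-cong n (λ i i<n → edgeWeight-toggle n k x i valid i<n) ⟩
    ∑< n (λ i → ⟦ raisable x i ⟧ * imbalance-weight k (blocksLeft x i) (blocksRight x i)) ∎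

-- Cutting a string at a raisable position

bit-++ʳ : ∀ {i m} (u : Vec Bool i) (z : Vec Bool m) k → bit (u ++ᵥ z) (k + i) ≡ bit z k
bit-++ʳ         []      z k rewrite +-identityʳ k = refl
bit-++ʳ {suc i} (a ∷ u) z k rewrite +-suc k i     = bit-++ʳ u z k

bit-++ˡ : ∀ {i m} (u : Vec Bool i) (z : Vec Bool m) {k} → k < i → bit (u ++ᵥ z) k ≡ bit u k
bit-++ˡ (a ∷ u) z {zero}  _         = refl
bit-++ˡ (a ∷ u) z {suc k} (s≤s k<i) = bit-++ˡ u z k<i

bitBefore-++ˡ : ∀ {i m} (u : Vec Bool i) (z : Vec Bool m) {k} → k ≤ i → bitBefore (u ++ᵥ z) k ≡ bitBefore u k
bitBefore-++ˡ u z {zero}  _   = refl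
bitBefore-++ˡ u z {suc k} k<i = bit-++ˡ u z k<i

blocksLeft-++ : ∀ {i m} (u : Vec Bool i) (z : Vec Bool m) → blocksLeft (u ++ᵥ z) i ≡ blocksLeft u i
blocksLeft-++ {zero}  u z = refl
blocksLeft-++ {suc k} u z = cong not (bitBefore-++ˡ u z (n≤1+n k))

1+i<ᵇi+m≡1<ᵇm : ∀ i m → (suc i <ᵇ i + m) ≡ (1 <ᵇ m)
1+i<ᵇi+m≡1<ᵇm zero    m = refl
1+i<ᵇi+m≡1<ᵇm (suc i) m = 1+i<ᵇi+m≡1<ᵇm i m

blocksRight-++ : ∀ {i m} (u : Vec Bool i) (z : Vec Bool m) → blocksRight (u ++ᵥ z) i ≡ blocksRight z 0
blocksRight-++ {i} {m} u z rewrite 1+i<ᵇi+m≡1<ᵇm i m | bit-++ʳ u z 2 = refl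

raisable-++ : ∀ {i m} (u : Vec Bool i) (z : Vec Bool m) → raisable (u ++ᵥ z) i ≡ not (bitBefore u i) ∧ raisable z 0
raisable-++ u z rewrite bitBefore-++ˡ u z ≤-refl | bit-++ʳ u z 0 | bit-++ʳ u z 1 = refl

noConsecOnes-++ : ∀ {i m} (u : Vec Bool i) (z : Vec Bool m) →
                  noConsecOnes (u ++ᵥ z) ≡ (noConsecOnes u ∧ not (bitBefore u i ∧ bit z 0)) ∧ noConsecOnes z
noConsecOnes-++ []          z        = refl
noConsecOnes-++ (true ∷ [])  []      = refl
noConsecOnes-++ (false ∷ []) []      = refl
noConsecOnes-++ (a ∷ [])    (c ∷ z)  = refl
noConsecOnes-++ (a ∷ b ∷ u) z
  rewrite noConsecOnes-++ (b ∷ u) z with not (a ∧ b)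
... | true  = refl
... | false = refl

raisableWeight-++ : ∀ {i m} (u : Vec Bool i) (z : Vec Bool m) (h : Bool → Bool → ℕ) →
  ⟦ noConsecOnes (u ++ᵥ z) ∧ raisable (u ++ᵥ z) i ⟧ * h (blocksLeft (u ++ᵥ z) i) (blocksRight (u ++ᵥ z) i)
    ≡ ⟦ noConsecOnes u ∧ not (bitBefore u i) ⟧ * (⟦ noConsecOnes z ∧ raisable z 0 ⟧ * h (blocksLeft u i) (blocksRight z 0))
raisableWeight-++ {i} u z h
  rewrite noConsecOnes-++ u z | raisable-++ u z | blocksLeft-++ u z | blocksRight-++ u z
        | ⟦∧⟧-* (noConsecOnes u ∧ not (bitBefore u i)) (noConsecOnes z ∧ raisable z 0) (h (blocksLeft u i) (blocksRight z 0))
        = cong (λ b → ⟦ b ⟧ * h (blocksLeft u i) (blocksRight z 0))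
               (regroup (noConsecOnes u) (bitBefore u i) (bit z 0) (noConsecOnes z) (not (bit z 1)))
  where
  regroup : ∀ p q r s t → ((p ∧ not (q ∧ r)) ∧ s) ∧ (not q ∧ (not r ∧ t)) ≡ (p ∧ not q) ∧ (s ∧ (not r ∧ t))
  regroup false q     r     s t = refl
  regroup true  true  r     s t = ∧-zeroʳ (not r ∧ s)
  regroup true  false true  s t = refl
  regroup true  false false s t = refl

-- Fibonacci counts

-- F (m - 1), with the convention F (-1) = 1.
Fprev : ℕ → ℕ
Fprev zero    = 1
Fprev (suc m) = F m

fibonacci-pair : (z o : ℕ → ℕ) → z 0 ≡ 1 → o 0 ≡ 0 →
                 (∀ m → z (suc m) ≡ z m + o m) → (∀ m → o (suc m) ≡ z m) →
                 ∀ m → z m ≡ F (suc m) × o m ≡ F m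
fibonacci-pair z o z₀ o₀ z-suc o-suc zero    = z₀ , o₀
fibonacci-pair z o z₀ o₀ z-suc o-suc (suc m) =
  let zm , om = fibonacci-pair z o z₀ o₀ z-suc o-suc m
  in trans (z-suc m) (cong₂ _+_ zm om) , trans (o-suc m) zm

⟦⟧-split-on : ∀ v b → ⟦ v ⟧ ≡ ⟦ v ∧ not b ⟧ + ⟦ v ∧ b ⟧
⟦⟧-split-on false b     = refl
⟦⟧-split-on true  true  = refl
⟦⟧-split-on true  false = refl

⟦⟧*⟦not⟧ : ∀ v b → ⟦ v ⟧ * ⟦ not b ⟧ ≡ ⟦ v ∧ not b ⟧
⟦⟧*⟦not⟧ v b = sym (⟦∧⟧ v (not b))

⟦⟧*⟦not-not⟧ : ∀ v b → ⟦ v ⟧ * ⟦ not (not b) ⟧ ≡ ⟦ v ∧ b ⟧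
⟦⟧*⟦not-not⟧ v b = trans (cong (λ c → ⟦ v ⟧ * ⟦ c ⟧) (not-involutive b)) (sym (⟦∧⟧ v b))

bit-∷ʳ : ∀ {i} (u : Vec Bool i) b → bit (u ∷ʳ b) i ≡ b
bit-∷ʳ []      b = refl
bit-∷ʳ (a ∷ u) b = bit-∷ʳ u b

bit-∷ʳ-< : ∀ {i} (u : Vec Bool i) b {k} → k < i → bit (u ∷ʳ b) k ≡ bit u k
bit-∷ʳ-< (a ∷ u) b {zero}  _         = refl
bit-∷ʳ-< (a ∷ u) b {suc k} (s≤s k<i) = bit-∷ʳ-< u b k<i

bitBefore-∷ʳ : ∀ {i} (u : Vec Bool i) b → bitBefore (u ∷ʳ b) i ≡ bitBefore u i
bitBefore-∷ʳ {zero}  u b = refl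
bitBefore-∷ʳ {suc i} u b = bit-∷ʳ-< u b ≤-refl

noConsecOnes-∷ʳ : ∀ {i} (u : Vec Bool i) b → noConsecOnes (u ∷ʳ b) ≡ noConsecOnes u ∧ not (bitBefore u i ∧ b)
noConsecOnes-∷ʳ []          b = refl
noConsecOnes-∷ʳ (a ∷ [])    b = ∧-identityʳ _
noConsecOnes-∷ʳ (a ∷ c ∷ u) b rewrite noConsecOnes-∷ʳ (c ∷ u) b = sym (∧-assoc (not (a ∧ c)) _ _)

∑Q-∷ʳ-false : ∀ k (g : Vec Bool (suc k) → ℕ) →
             ∑Q (suc k) (λ u → ⟦ noConsecOnes u ∧ not (bit u k) ⟧ * g u) ≡ ∑Q k (λ u → ⟦ noConsecOnes u ⟧ * g (u ∷ʳ false))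
∑Q-∷ʳ-false k g = trans (∑Q-∷ʳ k _) (∑-cong (allStrings k) pointwise)
  where
  pointwise : ∀ (u : Vec Bool k) → ⟦ noConsecOnes (u ∷ʳ false) ∧ not (bit (u ∷ʳ false) k) ⟧ * g (u ∷ʳ false)
                    + ⟦ noConsecOnes (u ∷ʳ true) ∧ not (bit (u ∷ʳ true) k) ⟧ * g (u ∷ʳ true)
                  ≡ ⟦ noConsecOnes u ⟧ * g (u ∷ʳ false)
  pointwise u rewrite noConsecOnes-∷ʳ u false | noConsecOnes-∷ʳ u true | bit-∷ʳ u false | bit-∷ʳ u true
                    | ∧-zeroʳ (bitBefore u k) | ∧-identityʳ (noConsecOnes u ∧ true) | ∧-identityʳ (noConsecOnes u)
                    | ∧-zeroʳ (noConsecOnes u ∧ not (bitBefore u k ∧ true)) = +-identityʳ _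

zeroTail oneTail : ℕ → ℕ
zeroTail i = ∑Q i (λ u → ⟦ noConsecOnes u ∧ not (bitBefore u i) ⟧)
oneTail  i = ∑Q i (λ u → ⟦ noConsecOnes u ∧ bitBefore u i ⟧)

zeroTail-suc : ∀ k → zeroTail (suc k) ≡ zeroTail k + oneTail k
zeroTail-suc k = begin
  zeroTail (suc k)
    ≡⟨ ∑-cong (allStrings (suc k)) (λ u → sym (*-identityʳ _)) ⟩
  ∑Q (suc k) (λ u → ⟦ noConsecOnes u ∧ not (bit u k) ⟧ * 1)
    ≡⟨ ∑Q-∷ʳ-false k (λ _ → 1) ⟩
  ∑Q k (λ u → ⟦ noConsecOnes u ⟧ * 1)
    ≡⟨ ∑-cong (allStrings k) (λ u → trans (*-identityʳ _) (⟦⟧-split-on (noConsecOnes u) (bitBefore u k))) ⟩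
  ∑Q k (λ u → ⟦ noConsecOnes u ∧ not (bitBefore u k) ⟧ + ⟦ noConsecOnes u ∧ bitBefore u k ⟧)
    ≡⟨ ∑-+ (allStrings k) _ _ ⟩
  zeroTail k + oneTail k ∎

oneTail-suc : ∀ k → oneTail (suc k) ≡ zeroTail k
oneTail-suc k = trans (∑Q-∷ʳ k _) (∑-cong (allStrings k) pointwise)
  where
  pointwise : ∀ (u : Vec Bool k) → ⟦ noConsecOnes (u ∷ʳ false) ∧ bit (u ∷ʳ false) k ⟧ + ⟦ noConsecOnes (u ∷ʳ true) ∧ bit (u ∷ʳ true) k ⟧
                  ≡ ⟦ noConsecOnes u ∧ not (bitBefore u k) ⟧
  pointwise u rewrite noConsecOnes-∷ʳ u false | noConsecOnes-∷ʳ u true | bit-∷ʳ u false | bit-∷ʳ u true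
                    | ∧-zeroʳ (noConsecOnes u ∧ not (bitBefore u k ∧ false)) | ∧-identityʳ (bitBefore u k)
                    | ∧-identityʳ (noConsecOnes u ∧ not (bitBefore u k)) = refl

zeroTail-oneTail : ∀ i → zeroTail i ≡ F (suc i) × oneTail i ≡ F i
zeroTail-oneTail = fibonacci-pair zeroTail oneTail refl refl zeroTail-suc oneTail-suc

leftCount-suc : ∀ k (g : Bool → ℕ) →
  ∑Q (suc k) (λ u → ⟦ noConsecOnes u ∧ not (bitBefore u (suc k)) ⟧ * g (blocksLeft u (suc k)))
    ≡ ∑Q k (λ u → ⟦ noConsecOnes u ⟧ * g (not (bitBefore u k)))
leftCount-suc k g = trans (∑Q-∷ʳ-false k (λ u → g (not (bitBefore u k))))
  (∑-cong (allStrings k) (λ u → cong (λ b → ⟦ noConsecOnes u ⟧ * g (not b)) (bitBefore-∷ʳ u false)))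

leftCount-blocked : ∀ i → ∑Q i (λ u → ⟦ noConsecOnes u ∧ not (bitBefore u i) ⟧ * ⟦ blocksLeft u i ⟧) ≡ F i
leftCount-blocked zero    = refl
leftCount-blocked (suc k) = trans (leftCount-suc k ⟦_⟧)
  (trans (∑-cong (allStrings k) (λ u → ⟦⟧*⟦not⟧ (noConsecOnes u) (bitBefore u k))) (proj₁ (zeroTail-oneTail k)))

leftCount-unblocked : ∀ i → ∑Q i (λ u → ⟦ noConsecOnes u ∧ not (bitBefore u i) ⟧ * ⟦ not (blocksLeft u i) ⟧) ≡ Fprev i
leftCount-unblocked zero    = refl
leftCount-unblocked (suc k) = trans (leftCount-suc k (λ b → ⟦ not b ⟧))
  (trans (∑-cong (allStrings k) (λ u → ⟦⟧*⟦not-not⟧ (noConsecOnes u) (bitBefore u k))) (proj₂ (zeroTail-oneTail k)))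

noConsecOnes-false∷ : ∀ {m} (w : Vec Bool m) → noConsecOnes (false ∷ w) ≡ noConsecOnes w
noConsecOnes-false∷ []      = refl
noConsecOnes-false∷ (b ∷ w) = refl

noConsecOnes-true∷ : ∀ {m} (w : Vec Bool m) → noConsecOnes (true ∷ w) ≡ not (bit w 0) ∧ noConsecOnes w
noConsecOnes-true∷ []      = refl
noConsecOnes-true∷ (b ∷ w) = refl

∑Q-false∷ : ∀ m (g : Vec Bool (suc m) → ℕ) →
            ∑Q (suc m) (λ w → ⟦ noConsecOnes w ∧ not (bit w 0) ⟧ * g w) ≡ ∑Q m (λ w → ⟦ noConsecOnes w ⟧ * g (false ∷ w))
∑Q-false∷ m g = begin
  ∑Q (suc m) (λ w → ⟦ noConsecOnes w ∧ not (bit w 0) ⟧ * g w)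
    ≡⟨ ∑Q-suc m _ ⟩
  ∑Q m (λ w → ⟦ noConsecOnes (false ∷ w) ∧ true ⟧ * g (false ∷ w)) + ∑Q m (λ w → ⟦ noConsecOnes (true ∷ w) ∧ false ⟧ * g (true ∷ w))
    ≡⟨ cong₂ _+_ (∑-cong (allStrings m) (λ w → cong (λ b → ⟦ b ⟧ * g (false ∷ w)) (trans (∧-identityʳ _) (noConsecOnes-false∷ w))))
                 (trans (∑-cong (allStrings m) (λ w → cong (λ b → ⟦ b ⟧ * g (true ∷ w)) (∧-zeroʳ (noConsecOnes (true ∷ w))))) (∑-zero (allStrings m))) ⟩
  ∑Q m (λ w → ⟦ noConsecOnes w ⟧ * g (false ∷ w)) + 0
    ≡⟨ +-identityʳ _ ⟩
  ∑Q m (λ w → ⟦ noConsecOnes w ⟧ * g (false ∷ w)) ∎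

zeroHead oneHead : ℕ → ℕ
zeroHead m = ∑Q m (λ w → ⟦ noConsecOnes w ∧ not (bit w 0) ⟧)
oneHead  m = ∑Q m (λ w → ⟦ noConsecOnes w ∧ bit w 0 ⟧)

zeroHead-suc : ∀ m → zeroHead (suc m) ≡ zeroHead m + oneHead m
zeroHead-suc m = begin
  zeroHead (suc m)
    ≡⟨ ∑-cong (allStrings (suc m)) (λ w → sym (*-identityʳ _)) ⟩
  ∑Q (suc m) (λ w → ⟦ noConsecOnes w ∧ not (bit w 0) ⟧ * 1)
    ≡⟨ ∑Q-false∷ m (λ _ → 1) ⟩
  ∑Q m (λ w → ⟦ noConsecOnes w ⟧ * 1)
    ≡⟨ ∑-cong (allStrings m) (λ w → trans (*-identityʳ _) (⟦⟧-split-on (noConsecOnes w) (bit w 0))) ⟩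
  ∑Q m (λ w → ⟦ noConsecOnes w ∧ not (bit w 0) ⟧ + ⟦ noConsecOnes w ∧ bit w 0 ⟧)
    ≡⟨ ∑-+ (allStrings m) _ _ ⟩
  zeroHead m + oneHead m ∎

oneHead-suc : ∀ m → oneHead (suc m) ≡ zeroHead m
oneHead-suc m = begin
  oneHead (suc m)
    ≡⟨ ∑Q-suc m _ ⟩
  ∑Q m (λ w → ⟦ noConsecOnes (false ∷ w) ∧ false ⟧) + ∑Q m (λ w → ⟦ noConsecOnes (true ∷ w) ∧ true ⟧)
    ≡⟨ cong₂ _+_ (trans (∑-cong (allStrings m) (λ w → cong ⟦_⟧ (∧-zeroʳ _))) (∑-zero (allStrings m)))
                 (∑-cong (allStrings m) (λ w → cong ⟦_⟧ (trans (∧-identityʳ _) (noConsecOnes-true∷ w)))) ⟩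
  ∑Q m (λ w → ⟦ not (bit w 0) ∧ noConsecOnes w ⟧)
    ≡⟨ ∑-cong (allStrings m) (λ w → cong ⟦_⟧ (∧-comm (not (bit w 0)) _)) ⟩
  zeroHead m ∎

zeroHead-oneHead : ∀ m → zeroHead m ≡ F (suc m) × oneHead m ≡ F m
zeroHead-oneHead = fibonacci-pair zeroHead oneHead refl refl zeroHead-suc oneHead-suc

rightCount-suc : ∀ k (g : Bool → ℕ) →
  ∑Q (suc (suc k)) (λ z → ⟦ noConsecOnes z ∧ raisable z 0 ⟧ * g (blocksRight z 0))
    ≡ ∑Q k (λ w → ⟦ noConsecOnes w ⟧ * g (not (bit w 0)))
rightCount-suc k g = begin
  ∑Q (suc (suc k)) (λ z → ⟦ noConsecOnes z ∧ (not (bit z 0) ∧ not (bit z 1)) ⟧ * g (blocksRight z 0))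
    ≡⟨ ∑-cong (allStrings (suc (suc k))) (λ z → peel (noConsecOnes z) (not (bit z 0)) (not (bit z 1)) _) ⟩
  ∑Q (suc (suc k)) (λ z → ⟦ noConsecOnes z ∧ not (bit z 0) ⟧ * (⟦ not (bit z 1) ⟧ * g (blocksRight z 0)))
    ≡⟨ ∑Q-false∷ (suc k) _ ⟩
  ∑Q (suc k) (λ w → ⟦ noConsecOnes w ⟧ * (⟦ not (bit w 0) ⟧ * g (not (bit w 1))))
    ≡⟨ ∑-cong (allStrings (suc k)) (λ w → ⟦∧⟧-* (noConsecOnes w) (not (bit w 0)) _) ⟩
  ∑Q (suc k) (λ w → ⟦ noConsecOnes w ∧ not (bit w 0) ⟧ * g (not (bit w 1)))
    ≡⟨ ∑Q-false∷ k _ ⟩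
  ∑Q k (λ w → ⟦ noConsecOnes w ⟧ * g (not (bit w 0))) ∎
  where
  peel : ∀ v a b t → ⟦ v ∧ (a ∧ b) ⟧ * t ≡ ⟦ v ∧ a ⟧ * (⟦ b ⟧ * t)
  peel v a b t = trans (cong (λ c → ⟦ c ⟧ * t) (sym (∧-assoc v a b))) (sym (⟦∧⟧-* (v ∧ a) b t))

rightCount-blocked : ∀ j → ∑Q (suc j) (λ z → ⟦ noConsecOnes z ∧ raisable z 0 ⟧ * ⟦ blocksRight z 0 ⟧) ≡ F j
rightCount-blocked zero    = refl
rightCount-blocked (suc k) = trans (rightCount-suc k ⟦_⟧)
  (trans (∑-cong (allStrings k) (λ w → ⟦⟧*⟦not⟧ (noConsecOnes w) (bit w 0))) (proj₁ (zeroHead-oneHead k)))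

rightCount-unblocked : ∀ j → ∑Q (suc j) (λ z → ⟦ noConsecOnes z ∧ raisable z 0 ⟧ * ⟦ not (blocksRight z 0) ⟧) ≡ Fprev j
rightCount-unblocked zero    = refl
rightCount-unblocked (suc k) = trans (rightCount-suc k (λ b → ⟦ not b ⟧))
  (trans (∑-cong (allStrings k) (λ w → ⟦⟧*⟦not-not⟧ (noConsecOnes w) (bit w 0))) (proj₂ (zeroHead-oneHead k)))

raisable-count : ∀ i j (h : Bool → Bool → ℕ) →
  ∑Q (i + suc j) (λ x → ⟦ noConsecOnes x ∧ raisable x i ⟧ * h (blocksLeft x i) (blocksRight x i))
    ≡ F i * (F j * h true true + Fprev j * h true false) + Fprev i * (F j * h false true + Fprev j * h false false)
raisable-count i j h = begin
  ∑Q (i + suc j) weight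
    ≡⟨ ∑Q-++ i (suc j) weight ⟩
  ∑Q i (λ u → ∑Q (suc j) (λ z → weight (u ++ᵥ z)))
    ≡⟨ ∑-cong (allStrings i) (λ u → trans (∑-cong (allStrings (suc j)) (λ z → raisableWeight-++ u z h))
                                          (∑-*ˡ (allStrings (suc j)) (left u) _)) ⟩
  ∑Q i (λ u → left u * ∑Q (suc j) (λ z → right z * h (blocksLeft u i) (blocksRight z 0)))
    ≡⟨ ∑-∑-split-on (allStrings i) (allStrings (suc j)) left right (λ u → blocksLeft u i) (λ z → blocksRight z 0) h ⟩
  _ ≡⟨ cong₂ _+_ (cong₂ _*_ (leftCount-blocked i) (with-right true))
                 (cong₂ _*_ (leftCount-unblocked i) (with-right false)) ⟩
  F i * (F j * h true true + Fprev j * h true false) + Fprev i * (F j * h false true + Fprev j * h false false) ∎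
  where
  weight : Vec Bool (i + suc j) → ℕ
  weight x = ⟦ noConsecOnes x ∧ raisable x i ⟧ * h (blocksLeft x i) (blocksRight x i)
  left : Vec Bool i → ℕ
  left u = ⟦ noConsecOnes u ∧ not (bitBefore u i) ⟧
  right : Vec Bool (suc j) → ℕ
  right z = ⟦ noConsecOnes z ∧ raisable z 0 ⟧
  with-right : ∀ α → ∑Q (suc j) (λ z → right z * ⟦ blocksRight z 0 ⟧) * h α true
                     + ∑Q (suc j) (λ z → right z * ⟦ not (blocksRight z 0) ⟧) * h α false
                   ≡ F j * h α true + Fprev j * h α false
  with-right α = cong₂ _+_ (cong (_* h α true) (rightCount-blocked j)) (cong (_* h α false) (rightCount-unblocked j))

edges-by-position : ∀ n k → edgesWithImbalance n k ≡
  ∑< n (λ i → F i * (F (n ∸ suc i) * ⟦ 2 ≡ᵇ k ⟧ + Fprev (n ∸ suc i) * ⟦ 1 ≡ᵇ k ⟧)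
            + Fprev i * (F (n ∸ suc i) * ⟦ 1 ≡ᵇ k ⟧ + Fprev (n ∸ suc i) * ⟦ 0 ≡ᵇ k ⟧))
edges-by-position n k = trans (edges≡∑raisable n k) (∑<-cong n (λ i i<n → at i (split i<n)))
  where
  split : ∀ {i} → i < n → n ≡ i + suc (n ∸ suc i)
  split {i} i<n = sym (trans (+-suc i _) (m+[n∸m]≡n i<n))
  at : ∀ {m} i {j} → m ≡ i + suc j →
       ∑Q m (λ x → ⟦ noConsecOnes x ∧ raisable x i ⟧ * imbalance-weight k (blocksLeft x i) (blocksRight x i))
         ≡ F i * (F j * ⟦ 2 ≡ᵇ k ⟧ + Fprev j * ⟦ 1 ≡ᵇ k ⟧) + Fprev i * (F j * ⟦ 1 ≡ᵇ k ⟧ + Fprev j * ⟦ 0 ≡ᵇ k ⟧)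
  at i {j} refl = raisable-count i j (imbalance-weight k)

conv : ℕ → ℕ
conv m = ∑< m (λ t → F (suc t) * F (m ∸ t))

conv-suc : ∀ m → ∑< (suc m) (λ i → F (suc i) * F (m ∸ i)) ≡ conv m
conv-suc m = begin
  ∑< (suc m) (λ i → F (suc i) * F (m ∸ i)) ≡⟨ ∑<-∷ʳ m (λ i → F (suc i) * F (m ∸ i)) ⟩
  conv m + F (suc m) * F (m ∸ m)           ≡⟨ cong (λ t → conv m + F (suc m) * F t) (n∸n≡0 m) ⟩
  conv m + F (suc m) * 0                   ≡⟨ cong (conv m +_) (*-zeroʳ (F (suc m))) ⟩
  conv m + 0                               ≡⟨ +-identityʳ _ ⟩
  conv m ∎

conv-Fprev : ∀ m → ∑< (suc (suc m)) (λ i → F (suc i) * Fprev (suc m ∸ i)) ≡ conv m + F (suc (suc m))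
conv-Fprev m = begin
  ∑< (suc (suc m)) (λ i → F (suc i) * Fprev (suc m ∸ i))
    ≡⟨ ∑<-∷ʳ (suc m) (λ i → F (suc i) * Fprev (suc m ∸ i)) ⟩
  ∑< (suc m) (λ i → F (suc i) * Fprev (suc m ∸ i)) + F (suc (suc m)) * Fprev (m ∸ m)
    ≡⟨ cong₂ _+_ (∑<-cong (suc m) (λ i i<1+m → cong (λ t → F (suc i) * Fprev t) (+-∸-assoc 1 (≤-pred i<1+m))))
                 (cong (λ t → F (suc (suc m)) * Fprev t) (n∸n≡0 m)) ⟩
  ∑< (suc m) (λ i → F (suc i) * F (m ∸ i)) + F (suc (suc m)) * 1
    ≡⟨ cong₂ _+_ (conv-suc m) (*-identityʳ _) ⟩
  conv m + F (suc (suc m)) ∎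

[c+m]∸t∸c≡m∸t : ∀ c m t → (c + m) ∸ t ∸ c ≡ m ∸ t
[c+m]∸t∸c≡m∸t c m t = trans (∸-+-assoc (c + m) t c) (trans (cong (c + m ∸_) (+-comm t c)) ([m+n]∸[m+o]≡n∸o c m t))

conv-shift : ∀ c m → ∑< m (λ t → F (suc t) * F ((c + m) ∸ t ∸ c)) ≡ conv m
conv-shift c m = ∑<-cong m (λ t _ → cong (λ s → F (suc t) * F s) ([c+m]∸t∸c≡m∸t c m t))

imbalance-2 : ∀ n → 2 ≤ n → edgesWithImbalance n 2 ≡ Σ-from-to 2 (n ∸ 1) (λ i → F (i ∸ 1) * F (n ∸ i))
imbalance-2 (suc zero)    (s≤s ())
imbalance-2 (suc (suc p)) _ = begin
  edgesWithImbalance (2 + p) 2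
    ≡⟨ edges-by-position (2 + p) 2 ⟩
  _ ≡⟨ ∑<-cong (2 + p) (λ i _ → select₂ (F i) (F (suc p ∸ i)) (Fprev i) (Fprev (suc p ∸ i))) ⟩
  ∑< (2 + p) (λ i → F i * F (suc p ∸ i))
    ≡⟨ conv-suc p ⟩
  conv p
    ≡⟨ Σ-from-to≡∑< 2 (suc p) _ ⟨
  Σ-from-to 2 (suc p) (λ i → F (i ∸ 1) * F (2 + p ∸ i)) ∎
  where
  select₂ : ∀ a b c d → a * (b * 1 + d * 0) + c * (b * 0 + d * 0) ≡ a * b
  select₂ = solve-∀

imbalance-1 : ∀ n → 2 ≤ n → edgesWithImbalance n 1 ≡ 2 * Σ-from-to 1 (n ∸ 3) (λ i → F i * F (n ∸ i ∸ 2)) + 2 * F (n ∸ 1)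
imbalance-1 (suc zero)          (s≤s ())
imbalance-1 (suc (suc zero))    _ = refl
imbalance-1 (suc (suc (suc q))) _ = begin
  edgesWithImbalance (3 + q) 1
    ≡⟨ edges-by-position (3 + q) 1 ⟩
  _ ≡⟨ ∑<-cong (3 + q) (λ i _ → select₁ (F i) (F (2 + q ∸ i)) (Fprev i) (Fprev (2 + q ∸ i))) ⟩
  ∑< (3 + q) (λ i → Fprev i * F (2 + q ∸ i) + F i * Fprev (2 + q ∸ i))
    ≡⟨ ∑<-+ (3 + q) (λ i → Fprev i * F (2 + q ∸ i)) (λ i → F i * Fprev (2 + q ∸ i)) ⟩
  (1 * F (2 + q) + ∑< (suc q) (λ i → F (suc i) * F (q ∸ i))) + ∑< (2 + q) (λ i → F (suc i) * Fprev (suc q ∸ i))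
    ≡⟨ cong₂ _+_ (cong (1 * F (2 + q) +_) (conv-suc q)) (conv-Fprev q) ⟩
  (1 * F (2 + q) + conv q) + (conv q + F (2 + q))
    ≡⟨ collect (F (2 + q)) (conv q) ⟩
  2 * conv q + 2 * F (2 + q)
    ≡⟨ cong (λ s → 2 * s + 2 * F (2 + q)) (trans (Σ-from-to≡∑< 1 q _) (conv-shift 2 q)) ⟨
  2 * Σ-from-to 1 q (λ i → F i * F (3 + q ∸ i ∸ 2)) + 2 * F (2 + q) ∎
  where
  select₁ : ∀ a b c d → a * (b * 0 + d * 1) + c * (b * 1 + d * 0) ≡ c * b + a * d
  select₁ = solve-∀
  collect : ∀ a s → (1 * a + s) + (s + a) ≡ 2 * s + 2 * a
  collect = solve-∀

imbalance-0 : ∀ n → 2 ≤ n → edgesWithImbalance n 0 ≡ Σ-from-to 3 (n ∸ 2) (λ i → F (i ∸ 2) * F (n ∸ i ∸ 1)) + 2 * F (n ∸ 2)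
imbalance-0 (suc zero)                (s≤s ())
imbalance-0 (suc (suc zero))          _ = refl
imbalance-0 (suc (suc (suc zero)))    _ = refl
imbalance-0 (suc (suc (suc (suc r)))) _ = begin
  edgesWithImbalance (4 + r) 0
    ≡⟨ edges-by-position (4 + r) 0 ⟩
  _ ≡⟨ ∑<-cong (4 + r) (λ i _ → select₀ (F i) (F (3 + r ∸ i)) (Fprev i) (Fprev (3 + r ∸ i))) ⟩
  1 * F (2 + r) + ∑< (2 + r) (λ i → F (suc i) * Fprev (suc r ∸ i))
    ≡⟨ cong (1 * F (2 + r) +_) (conv-Fprev r) ⟩
  1 * F (2 + r) + (conv r + F (2 + r))
    ≡⟨ collect (F (2 + r)) (conv r) ⟩
  conv r + 2 * F (2 + r)
    ≡⟨ cong (_+ 2 * F (2 + r)) (trans (Σ-from-to≡∑< 3 (2 + r) _) (conv-shift 1 r)) ⟨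
  Σ-from-to 3 (2 + r) (λ i → F (i ∸ 2) * F (4 + r ∸ i ∸ 1)) + 2 * F (2 + r) ∎
  where
  select₀ : ∀ a b c d → a * (b * 0 + d * 0) + c * (b * 0 + d * 1) ≡ c * d
  select₀ = solve-∀
  collect : ∀ a s → 1 * a + (s + a) ≡ s + 2 * a
  collect = solve-∀

mainTheorem4 : (n : ℕ) → 2 ≤ n →
    (edgesWithImbalance n 0 ≡ Σ-from-to 3 (n ∸ 2) (λ i → F (i ∸ 2) * F (n ∸ i ∸ 1)) + 2 * F (n ∸ 2))
    × (edgesWithImbalance n 1 ≡ 2 * Σ-from-to 1 (n ∸ 3) (λ i → F i * F (n ∸ i ∸ 2)) + 2 * F (n ∸ 1))
    × (edgesWithImbalance n 2 ≡ Σ-from-to 2 (n ∸ 1) (λ i → F (i ∸ 1) * F (n ∸ i)))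
mainTheorem4 n 2≤n = imbalance-0 n 2≤n , imbalance-1 n 2≤n , imbalance-2 n 2≤n
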